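{- Let $k$ be a positive integer. Let $\vec v_1\in P_k$ and $\vec v_2\in clP_k$, and consider two sequences of permutations $(\sigma_1^m)_{m\in\mathbb N}$ and $(\sigma_2^m)_{m\in\mathbb N}$ such that $$|\sigma_1^m|\to\infty,\quad (\widetilde{\mathrm{c\text{ - }occ}}(\pi,\sigma_1^m))_{\pi\in\mathcal S_k}\to\vec v_1,\qquad |\sigma_2^m|\to\infty,\quad (\widetilde{\mathrm{occ}}(\pi,\sigma_2^m))_{\pi\in\mathcal S_k}\to\vec v_2.$$ Define $\sigma_3^m:=\sigma_2^m[\sigma_1^m,\dots,\sigma_1^m]$ for all $m\in\mathbb N$. Then $$|\sigma_3^m|\to\infty,\quad (\widetilde{\mathrm{c\text{ - }occ}}(\pi,\sigma_3^m))_{\pi\in\mathcal S_k}\to\vec v_1,\quad (\widetilde{\mathrm{occ}}(\pi,\sigma_3^m))_{\pi\in\mathcal S_k}\to\vec v_2.$$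
   Context: $\mathcal S_n$ is the set of permutations of size $n$ (one-line notation). For $\sigma\in\mathcal S_n$, $\pi\in\mathcal S_k$: $\mathrm{occ}(\pi,\sigma)$ is the number of index sets $i_1<\dots<i_k$ such that $\sigma(i_1)\dots\sigma(i_k)$ has the same relative order as $\pi$, and $\widetilde{\mathrm{occ}}(\pi,\sigma)=\mathrm{occ}(\pi,\sigma)/\binom nk$; $\mathrm{c\text{ - }occ}(\pi,\sigma)$ is the number of such occurrences whose indices form an interval $i,i+1,\dots,i+k-1$, and $\widetilde{\mathrm{c\text{ - }occ}}(\pi,\sigma)=\mathrm{c\text{ - }occ}(\pi,\sigma)/n$. $P_k$ (resp. $clP_k$) is the set of $\vec v\in[0,1]^{\mathcal S_k}$ such that some sequence $(\sigma^m)$ with $|\sigma^m|\to\infty$ satisfies $\widetilde{\mathrm{c\text{ - }occ}}(\pi,\sigma^m)\to\vec v_\pi$ (resp. $\widetilde{\mathrm{occ}}(\pi,\sigma^m)\to\vec v_\pi$) for all $\pi\in\mathcal S_k$. For $\sigma\in\mathcal S_n$ and permutations $\tau_1,\dots,\tau_n$, the inflation $\sigma[\tau_1,\dots,\tau_n]$ is the permutation formed by consecutive disjoint blocks $\tau'_1,\dots,\tau'_n$ (from left to right), each block $\tau_i'$ consisting of a set of consecutive values and having the same relative order as $\tau_i$, with the blocks' value sets ordered relative to each other as given by $\sigma$. -}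

module Defs where

open import Data.Nat as ℕ using (ℕ; zero; suc; _≤_; _<ᵇ_; _≡ᵇ_)
open import Data.Nat.Combinatorics using (_C_)
open import Data.Fin as Fin using (Fin; toℕ; combine; remQuot)
open import Data.Fin.Properties using (remQuot-combine; combine-remQuot)
open import Data.Fin.Permutation using (Permutation′; permutation; _⟨$⟩ʳ_; _⟨$⟩ˡ_; inverseˡ; inverseʳ)
open import Data.Vec as Vec using (Vec; []; _∷_; lookup)
open import Data.List as List using (List; []; _∷_; _++_; allFin; concatMap)
open import Data.Bool using (Bool; true; false; _∧_; if_then_else_)
open import Data.Integer as ℤ using (+_; -_)
open import Data.Rational as ℚ using (ℚ; 0ℚ; 1ℚ; _-_; ∣_∣; _+_)
open import Data.Product using (Σ; ∃; _×_; _,_; proj₁; proj₂)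
open import Relation.Binary.PropositionalEquality using (_≡_; refl; cong; cong₂; trans; sym)

-- A permutation of size n is a bijection Fin n ↔ Fin n; its one-line
-- notation is σ(0) σ(1) … σ(n-1).
Perm : Set
Perm = Σ ℕ Permutation′

size : Perm → ℕ
size = proj₁

_at_ : ∀ {n} → Permutation′ n → Fin n → Fin n
σ at i = σ ⟨$⟩ʳ i

-- Index sets i₁ < … < i_k, as increasing vectors (sub-sequences of a list)

choose : ∀ {A : Set} (k : ℕ) → List A → List (Vec A k)
choose zero    xs       = [] ∷ []
choose (suc k) []       = []
choose (suc k) (x ∷ xs) = List.map (x ∷_) (choose k xs) ++ choose (suc k) xs

indexSets : (k n : ℕ) → List (Vec (Fin n) k)
indexSets k n = choose k (allFin n)

countᵇ : ∀ {A : Set} → (A → Bool) → List A → ℕ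
countᵇ p []       = 0
countᵇ p (x ∷ xs) = if p x then suc (countᵇ p xs) else countᵇ p xs

allᵇ : ∀ {A : Set} → (A → Bool) → List A → Bool
allᵇ p []       = true
allᵇ p (x ∷ xs) = p x ∧ allᵇ p xs

_==ᵇ_ : Bool → Bool → Bool
true  ==ᵇ b = b
false ==ᵇ true  = false
false ==ᵇ false = true

isOccᵇ : ∀ {k n} → Permutation′ k → Permutation′ n → Vec (Fin n) k → Bool
isOccᵇ {k} π σ is =
  allᵇ (λ a → allᵇ (λ b →
        (toℕ (π at a) <ᵇ toℕ (π at b))
    ==ᵇ (toℕ (σ at lookup is a) <ᵇ toℕ (σ at lookup is b)))
    (allFin k)) (allFin k)

consecutiveᵇ : ∀ {n k} → Vec (Fin n) k → Bool
consecutiveᵇ []           = true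
consecutiveᵇ (i ∷ [])     = true
consecutiveᵇ (i ∷ j ∷ is) = (suc (toℕ i) ≡ᵇ toℕ j) ∧ consecutiveᵇ (j ∷ is)

occ : ∀ {k} → Permutation′ k → Perm → ℕ
occ {k} π (n , σ) = countᵇ (isOccᵇ π σ) (indexSets k n)

c-occ : ∀ {k} → Permutation′ k → Perm → ℕ
c-occ {k} π (n , σ) =
  countᵇ (λ is → isOccᵇ π σ is ∧ consecutiveᵇ is) (indexSets k n)

-- a / d as a rational; convention a / 0 := 0 (only relevant for finitely
-- many terms of sequences of diverging size)
ratio : ℕ → ℕ → ℚ
ratio a zero    = 0ℚ
ratio a (suc d) = (+ a) ℚ./ suc d

occ~ : ∀ {k} → Permutation′ k → Perm → ℚ
occ~ {k} π σ = ratio (occ π σ) (size σ C k)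

c-occ~ : ∀ {k} → Permutation′ k → Perm → ℚ
c-occ~ π σ = ratio (c-occ π σ) (size σ)

-- Inflation σ[τ, …, τ] (all blocks equal to τ)
-- Position combine i r (= i·p + r, block i, offset r) receives value
-- combine (σ i) (τ r) (= σ(i)·p + τ(r)).

inflate : Perm → Perm → Perm
inflate (n , σ) (p , τ) = ℕ._*_ n p , permutation f g f∘g g∘f
  where
  f : Fin (ℕ._*_ n p) → Fin (ℕ._*_ n p)
  f x = combine (σ ⟨$⟩ʳ proj₁ (remQuot {n} p x)) (τ ⟨$⟩ʳ proj₂ (remQuot {n} p x))
  g : Fin (ℕ._*_ n p) → Fin (ℕ._*_ n p)
  g y = combine (σ ⟨$⟩ˡ proj₁ (remQuot {n} p y)) (τ ⟨$⟩ˡ proj₂ (remQuot {n} p y))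
  f∘g : ∀ y → f (g y) ≡ y
  f∘g y = trans
    (cong₂ combine
      (trans (cong (λ q → σ ⟨$⟩ʳ proj₁ q) (remQuot-combine {n} {p} _ _)) (inverseʳ σ))
      (trans (cong (λ q → τ ⟨$⟩ʳ proj₂ q) (remQuot-combine {n} {p} _ _)) (inverseʳ τ)))
    (combine-remQuot {n} p y)
  g∘f : ∀ x → g (f x) ≡ x
  g∘f x = trans
    (cong₂ combine
      (trans (cong (λ q → σ ⟨$⟩ˡ proj₁ q) (remQuot-combine {n} {p} _ _)) (inverseˡ σ))
      (trans (cong (λ q → τ ⟨$⟩ˡ proj₂ q) (remQuot-combine {n} {p} _ _)) (inverseˡ τ)))
    (combine-remQuot {n} p x)

-- Real numbers (Bishop): regular Cauchy sequences of rationals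

1/[1+_] : ℕ → ℚ
1/[1+ n ] = (+ 1) ℚ./ suc n

Regular : (ℕ → ℚ) → Set
Regular r = ∀ m n → ∣ r m - r n ∣ ℚ.≤ 1/[1+ m ] + 1/[1+ n ]

ℝ : Set
ℝ = Σ (ℕ → ℚ) Regular

-- |q - x| ≤ ε for q ∈ ℚ, x ∈ ℝ, ε ∈ ℚ
dist≤ : ℚ → ℝ → ℚ → Set
dist≤ q (x , _) ε = ∀ n → ∣ q - x n ∣ ℚ.≤ ε + 1/[1+ n ]

-- 0 ≤ x ≤ 1
InUnit : ℝ → Set
InUnit (x , _) = ∀ n → (ℚ.- 1/[1+ n ]) ℚ.≤ x n × x n ℚ.≤ 1ℚ + 1/[1+ n ]

_⟶_ : (ℕ → ℚ) → ℝ → Set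
a ⟶ x = ∀ (ε : ℚ) → 0ℚ ℚ.< ε → ∃ λ M → ∀ m → M ≤ m → dist≤ (a m) x ε

SizeDiverges : (ℕ → Perm) → Set
SizeDiverges s = ∀ B → ∃ λ M → ∀ m → M ≤ m → B ≤ size (s m)

PVec : ℕ → Set
PVec k = Permutation′ k → ℝ

CConv : ∀ k → (ℕ → Perm) → PVec k → Set
CConv k s v = ∀ (π : Permutation′ k) → (λ m → c-occ~ π (s m)) ⟶ v π

Conv : ∀ k → (ℕ → Perm) → PVec k → Set
Conv k s v = ∀ (π : Permutation′ k) → (λ m → occ~ π (s m)) ⟶ v π

InCube : ∀ {k} → PVec k → Set
InCube v = ∀ π → InUnit (v π)

P : ∀ k → PVec k → Set
P k v = InCube v × ∃ λ (s : ℕ → Perm) → SizeDiverges s × CConv k s v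

clP : ∀ k → PVec k → Set
clP k v = InCube v × ∃ λ (s : ℕ → Perm) → SizeDiverges s × Conv k s v

module Submission where

-- Write σ[τ] for σ inflated by n = |σ| copies of τ (|τ| = p).  The proof is
-- quantitative: for π ∈ 𝒮_{k+1},
--   |c-occ~(π, σ[τ]) - c-occ~(π, τ)| ≤ k / p,
-- since every window inside one of the n blocks is a window of τ and only
-- n·k windows are not of this form; and for π ∈ 𝒮_k with k ≤ n,
--   |occ~(π, σ[τ]) - occ~(π, σ)| ≤ C(k,2) / n,
-- since each k-set of indices of σ yields p^k index sets of σ[τ] meeting k
-- distinct blocks, with the same pattern, while the remaining index sets are
-- few: n·C(np,k) ≤ n·p^k·C(n,k) + C(k,2)·C(np,k) (`binomial-defect`).
-- Both errors tend to 0 as the sizes diverge, so the limits transfer.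

open import Defs
open import Data.Bool using (Bool; true; false; _∧_; not)
open import Data.Empty using (⊥-elim)
open import Data.Unit using (⊤; tt)
open import Data.Product using (∃; _×_; _,_; proj₁; proj₂)
open import Data.Sum using (inj₁; inj₂)
open import Function using (_∘_)
open import Relation.Binary.PropositionalEquality
open import Relation.Binary.Definitions using (tri<; tri≈; tri>)
open import Relation.Nullary using (yes; no)

open import Data.Nat using (ℕ; zero; suc; _≤_; _<_; _<ᵇ_; _≡ᵇ_; z≤n; s≤s; _+_; _*_; _^_; _⊔_; _≤?_)
open import Data.Nat.Properties
open import Data.Nat.Combinatorics using (_C_; nCk+nC[k+1]≡[n+1]C[k+1])
open import Data.Nat.Solver using (module +-*-Solver)
open import Data.Integer as ℤ using (+_; -[1+_])
import Data.Integer.Properties as ℤₚ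
import Data.Integer.Solver
open import Data.Rational as ℚ using (ℚ; mkℚ; 0ℚ; _-_; ∣_∣; toℚᵘ)
import Data.Rational.Properties as ℚₚ
import Data.Rational.Solver
open import Data.Rational.Unnormalised as ℚᵘ using (mkℚᵘ; *≤*)
import Data.Rational.Unnormalised.Properties as ℚᵘₚ

open import Data.Fin as Fin using (Fin; toℕ; combine; _↑ˡ_; _↑ʳ_)
open import Data.Fin.Properties using (toℕ-combine; remQuot-combine; combine-monoˡ-<; toℕ-injective)
open import Data.Fin.Permutation using (Permutation′; _⟨$⟩ˡ_; inverseˡ)
open import Data.List as List using (List; []; _∷_; _++_; allFin; tabulate; length; concat; concatMap)
import Data.List.Properties as Listₚ
open import Data.List.Membership.Propositional using (_∈_)
open import Data.List.Relation.Unary.Any using (here; there)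
import Data.List.Relation.Unary.All as ListAll
open import Data.List.Relation.Unary.AllPairs using (_∷_)
open import Data.List.Relation.Unary.Unique.Propositional using () renaming (Unique to ListUnique)
open import Data.List.Relation.Unary.Unique.Propositional.Properties using (allFin⁺)
open import Data.Vec as Vec using (Vec; []; _∷_; lookup)
import Data.Vec.Properties as Vecₚ
import Data.Vec.Relation.Unary.All as VecAll
open import Data.Vec.Relation.Unary.Unique.Propositional using ([]; _∷_) renaming (Unique to VecUnique)
import Data.Vec.Relation.Unary.Unique.Propositional.Properties as VecUniqueₚ

open +-*-Solver

count-++ : ∀ {A : Set} (P : A → Bool) xs ys →
  countᵇ P (xs ++ ys) ≡ countᵇ P xs + countᵇ P ys
count-++ P []       ys = refl
count-++ P (x ∷ xs) ys with P x
... | true  = cong suc (count-++ P xs ys)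
... | false = count-++ P xs ys

count-map : ∀ {A B : Set} (P : B → Bool) (f : A → B) xs →
  countᵇ P (List.map f xs) ≡ countᵇ (P ∘ f) xs
count-map P f []       = refl
count-map P f (x ∷ xs) with P (f x)
... | true  = cong suc (count-map P f xs)
... | false = count-map P f xs

count-cong : ∀ {A : Set} {P Q : A → Bool} → (∀ x → P x ≡ Q x) →
  ∀ xs → countᵇ P xs ≡ countᵇ Q xs
count-cong P≗Q []       = refl
count-cong {Q = Q} P≗Q (x ∷ xs) rewrite P≗Q x with Q x
... | true  = cong suc (count-cong P≗Q xs)
... | false = count-cong P≗Q xs

count-none : ∀ {A : Set} {P : A → Bool} → (∀ x → P x ≡ false) →
  ∀ xs → countᵇ P xs ≡ 0
count-none never []       = refl
count-none never (x ∷ xs) rewrite never x = count-none never xs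

count-all : ∀ {A : Set} (xs : List A) → countᵇ (λ _ → true) xs ≡ length xs
count-all []       = refl
count-all (x ∷ xs) = cong suc (count-all xs)

count-not : ∀ {A : Set} (P : A → Bool) xs →
  countᵇ P xs + countᵇ (not ∘ P) xs ≡ length xs
count-not P []       = refl
count-not P (x ∷ xs) with P x
... | true  = cong suc (count-not P xs)
... | false = trans (+-suc _ _) (cong suc (count-not P xs))

count-split : ∀ {A : Set} (P Q : A → Bool) xs →
  countᵇ (λ x → P x ∧ Q x) xs + countᵇ (λ x → not (P x) ∧ Q x) xs ≡ countᵇ Q xs
count-split P Q []       = refl
count-split P Q (x ∷ xs) with P x | Q x
... | true  | true  = cong suc (count-split P Q xs)
... | true  | false = count-split P Q xs
... | false | true  = trans (+-suc _ _) (cong suc (count-split P Q xs))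
... | false | false = count-split P Q xs

count-choose-∷ : ∀ {A : Set} k (Q : Vec A (suc k) → Bool) y ys →
  countᵇ Q (choose (suc k) (y ∷ ys))
    ≡ countᵇ (λ v → Q (y ∷ v)) (choose k ys) + countᵇ Q (choose (suc k) ys)
count-choose-∷ k Q y ys = trans (count-++ Q (List.map (y ∷_) (choose k ys)) _)
  (cong (_+ countᵇ Q (choose (suc k) ys)) (count-map Q (y ∷_) (choose k ys)))

choose-map : ∀ {A B : Set} (f : A → B) k xs →
  choose k (List.map f xs) ≡ List.map (Vec.map f) (choose k xs)
choose-map f zero    xs       = refl
choose-map f (suc k) []       = refl
choose-map f (suc k) (x ∷ xs) = begin
  List.map (f x ∷_) (choose k (List.map f xs)) ++ choose (suc k) (List.map f xs)
    ≡⟨ cong₂ (λ l r → List.map (f x ∷_) l ++ r) (choose-map f k xs) (choose-map f (suc k) xs) ⟩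
  List.map (f x ∷_) (List.map (Vec.map f) (choose k xs)) ++ List.map (Vec.map f) (choose (suc k) xs)
    ≡⟨ cong (_++ _) (trans (sym (Listₚ.map-∘ (choose k xs))) (Listₚ.map-∘ (choose k xs))) ⟩
  List.map (Vec.map f) (List.map (x ∷_) (choose k xs)) ++ List.map (Vec.map f) (choose (suc k) xs)
    ≡⟨ Listₚ.map-++ (Vec.map f) (List.map (x ∷_) (choose k xs)) _ ⟨
  List.map (Vec.map f) (List.map (x ∷_) (choose k xs) ++ choose (suc k) xs) ∎
  where open ≡-Reasoning

-- Counting sub-sequences is superadditive under concatenation: those lying
-- entirely in ys or entirely in zs are distinct sub-sequences of ys ++ zs.
count-choose-superadditive : ∀ {A : Set} k (Q : Vec A (suc k) → Bool) ys zs →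
  countᵇ Q (choose (suc k) ys) + countᵇ Q (choose (suc k) zs)
    ≤ countᵇ Q (choose (suc k) (ys ++ zs))
count-choose-monoˡ : ∀ {A : Set} k (Q : Vec A k → Bool) ys zs →
  countᵇ Q (choose k ys) ≤ countᵇ Q (choose k (ys ++ zs))
count-choose-monoʳ : ∀ {A : Set} k (Q : Vec A k → Bool) ys zs →
  countᵇ Q (choose k zs) ≤ countᵇ Q (choose k (ys ++ zs))

count-choose-superadditive k Q []       zs = ≤-refl
count-choose-superadditive {A} k Q (y ∷ ys) zs = begin
  countᵇ Q (choose (suc k) (y ∷ ys)) + countᵇ Q (choose (suc k) zs)
    ≡⟨ cong (_+ countᵇ Q (choose (suc k) zs)) (count-choose-∷ k Q y ys) ⟩
  (Qy ys + countᵇ Q (choose (suc k) ys)) + countᵇ Q (choose (suc k) zs)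
    ≡⟨ +-assoc (Qy ys) _ _ ⟩
  Qy ys + (countᵇ Q (choose (suc k) ys) + countᵇ Q (choose (suc k) zs))
    ≤⟨ +-mono-≤ (count-choose-monoˡ k (λ v → Q (y ∷ v)) ys zs)
                (count-choose-superadditive k Q ys zs) ⟩
  Qy (ys ++ zs) + countᵇ Q (choose (suc k) (ys ++ zs))
    ≡⟨ count-choose-∷ k Q y (ys ++ zs) ⟨
  countᵇ Q (choose (suc k) (y ∷ ys ++ zs)) ∎
  where
  open ≤-Reasoning
  Qy : List A → ℕ
  Qy xs = countᵇ (λ v → Q (y ∷ v)) (choose k xs)

count-choose-monoˡ zero    Q ys zs = ≤-refl
count-choose-monoˡ (suc k) Q ys zs =
  ≤-trans (m≤m+n _ _) (count-choose-superadditive k Q ys zs)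

count-choose-monoʳ zero    Q ys zs = ≤-refl
count-choose-monoʳ (suc k) Q ys zs =
  ≤-trans (m≤n+m _ _) (count-choose-superadditive k Q ys zs)

count-choose-concat : ∀ {A : Set} k (Q : Vec A (suc k) → Bool) {m} (F : Fin m → List A) c →
  (∀ b → c ≤ countᵇ Q (choose (suc k) (F b))) →
  m * c ≤ countᵇ Q (choose (suc k) (concat (tabulate F)))
count-choose-concat k Q {zero}  F c good = z≤n
count-choose-concat k Q {suc m} F c good =
  ≤-trans (+-mono-≤ (good Fin.zero) (count-choose-concat k Q (F ∘ Fin.suc) c (good ∘ Fin.suc)))
          (count-choose-superadditive k Q (F Fin.zero) (concat (tabulate (F ∘ Fin.suc))))

count-choose-prefix : ∀ {A : Set} {p} k (Q : Vec A (suc k) → Bool) (g : Fin p → A) zs c →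
  (∀ r → c ≤ countᵇ (λ v → Q (g r ∷ v)) (choose k zs)) →
  p * c + countᵇ Q (choose (suc k) zs) ≤ countᵇ Q (choose (suc k) (tabulate g ++ zs))
count-choose-prefix {p = zero}  k Q g zs c good = ≤-refl
count-choose-prefix {p = suc p} k Q g zs c good = begin
  (c + p * c) + countᵇ Q (choose (suc k) zs)
    ≡⟨ +-assoc c _ _ ⟩
  c + (p * c + countᵇ Q (choose (suc k) zs))
    ≤⟨ +-mono-≤ (≤-trans (good Fin.zero) (count-choose-monoʳ k _ (tabulate (g ∘ Fin.suc)) zs))
                (count-choose-prefix k Q (g ∘ Fin.suc) zs c (good ∘ Fin.suc)) ⟩
  countᵇ (λ v → Q (g Fin.zero ∷ v)) (choose k (tabulate (g ∘ Fin.suc) ++ zs))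
    + countᵇ Q (choose (suc k) (tabulate (g ∘ Fin.suc) ++ zs))
    ≡⟨ count-choose-∷ k Q (g Fin.zero) _ ⟨
  countᵇ Q (choose (suc k) (tabulate g ++ zs)) ∎
  where open ≤-Reasoning

tabulate-++ : ∀ {A : Set} m n (f : Fin (m + n) → A) →
  tabulate f ≡ tabulate (f ∘ (_↑ˡ n)) ++ tabulate (f ∘ (m ↑ʳ_))
tabulate-++ zero    n f = refl
tabulate-++ (suc m) n f = cong (f Fin.zero ∷_) (tabulate-++ m n (f ∘ Fin.suc))

tabulate-combine : ∀ {A : Set} n p (f : Fin (n * p) → A) →
  tabulate f ≡ concat (tabulate (λ b → tabulate (f ∘ combine {n} {p} b)))
tabulate-combine zero    p f = refl
tabulate-combine (suc n) p f = trans (tabulate-++ p (n * p) f)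
  (cong (tabulate (f ∘ (_↑ˡ n * p)) ++_) (tabulate-combine n p (f ∘ (p ↑ʳ_))))

binom : ℕ → ℕ → ℕ
binom n       zero    = 1
binom zero    (suc k) = 0
binom (suc n) (suc k) = binom n k + binom n (suc k)

length-choose : ∀ {A : Set} k (xs : List A) → length (choose k xs) ≡ binom (length xs) k
length-choose zero    xs       = refl
length-choose (suc k) []       = refl
length-choose (suc k) (x ∷ xs) = trans (Listₚ.length-++ (List.map (x ∷_) (choose k xs)))
  (cong₂ _+_ (trans (Listₚ.length-map (x ∷_) (choose k xs)) (length-choose k xs))
             (length-choose (suc k) xs))

binom≡C : ∀ n k → binom n k ≡ n C k
binom≡C n       zero    = refl
binom≡C zero    (suc k) = refl
binom≡C (suc n) (suc k) =
  trans (cong₂ _+_ (binom≡C n k) (binom≡C n (suc k))) (nCk+nC[k+1]≡[n+1]C[k+1] n k)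

-- C(n,1) = n, so that C(k+1,2) = k + C(k,2)
binom-1 : ∀ n → binom n 1 ≡ n
binom-1 zero    = refl
binom-1 (suc n) = cong suc (binom-1 n)

binom-pos : ∀ n k → k ≤ n → 1 ≤ binom n k
binom-pos n       zero    _         = s≤s z≤n
binom-pos (suc n) (suc k) (s≤s k≤n) = ≤-trans (binom-pos n k k≤n) (m≤m+n _ _)

-- The absorption identity (k+1)·C(x,k+1) + k·C(x,k) = x·C(x,k), in the
-- subtraction-free form used to compare C(x,k+1) with C(x,k).
binom-absorption : ∀ x k → suc k * binom x (suc k) + k * binom x k ≡ x * binom x k
binom-absorption zero    zero    = refl
binom-absorption zero    (suc k) =
  solve 1 (λ k → (con 2 :+ k) :* con 0 :+ (con 1 :+ k) :* con 0 := con 0) refl k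
binom-absorption (suc x) zero rewrite binom-1 x =
  solve 1 (λ x → con 1 :* (con 1 :+ x) :+ con 0 :* con 1 := (con 1 :+ x) :* con 1) refl x
binom-absorption (suc x) (suc k) = begin
  (2 + k) * (b + c) + (1 + k) * (a + b)
    ≡⟨ solve 4 (λ k a b c → (con 2 :+ k) :* (b :+ c) :+ (con 1 :+ k) :* (a :+ b)
         := (con 2 :+ k) :* b :+ ((con 2 :+ k) :* c :+ (con 1 :+ k) :* b) :+ (con 1 :+ k) :* a)
         refl k a b c ⟩
  (2 + k) * b + ((2 + k) * c + (1 + k) * b) + (1 + k) * a
    ≡⟨ cong (λ t → (2 + k) * b + t + (1 + k) * a) (binom-absorption x (suc k)) ⟩
  (2 + k) * b + x * b + (1 + k) * a
    ≡⟨ solve 4 (λ k a b x → (con 2 :+ k) :* b :+ x :* b :+ (con 1 :+ k) :* a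
         := ((con 1 :+ k) :* b :+ k :* a) :+ a :+ x :* b :+ b) refl k a b x ⟩
  ((1 + k) * b + k * a) + a + x * b + b
    ≡⟨ cong (λ t → t + a + x * b + b) (binom-absorption x k) ⟩
  x * a + a + x * b + b
    ≡⟨ solve 3 (λ a b x → x :* a :+ a :+ x :* b :+ b := (con 1 :+ x) :* (a :+ b)) refl a b x ⟩
  (1 + x) * (a + b) ∎
  where
  open ≡-Reasoning
  a = binom x k
  b = binom x (suc k)
  c = binom x (suc (suc k))

-- The defect inequality: a k-subset of a set of n·p points, grouped into n
-- blocks of size p, meets k distinct blocks except with probability at most
-- C(k,2)/n.  Written multiplicatively, with A = C(np,k) and the lower bound
-- p^k·C(n,k) ≤ C(np,k) (proved by counting below) as a hypothesis:
--   n·A ≤ n·p^k·C(n,k) + C(k,2)·A.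
-- defect-step is the inductive step k ↦ k+1, phrased for arbitrary numbers
-- satisfying the two absorption identities; it is only needed when
-- C(k+1,2) = k + C(k,2) ≤ n, the other case being trivial.
defect-step : ∀ n p k c {A A′ S S′} → k + c ≤ n →
  suc k * A′ + k * A ≡ n * p * A →
  suc k * S′ + k * S ≡ n * S →
  n * A ≤ n * (p ^ k * S) + c * A →
  p ^ k * S ≤ A →
  n * A′ ≤ n * (p ^ suc k * S′) + (k + c) * A′
defect-step n p k c {A} {A′} {S} {S′} k+c≤n absA absS ih B≤A =
  *-cancelˡ-≤ (suc k) (+-cancelʳ-≤ X _ _ (begin
    suc k * (n * A′) + X
      ≡⟨ solve 7 (λ k n p A A′ B c′ → (con 1 :+ k) :* (n :* A′) :+ (n :* k :* A :+ n :* k :* p :* B :+ c′ :* k :* A)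
           := n :* ((con 1 :+ k) :* A′ :+ k :* A) :+ n :* k :* p :* B :+ c′ :* k :* A) refl k n p A A′ B c′ ⟩
    n * (suc k * A′ + k * A) + n * k * p * B + c′ * k * A
      ≡⟨ cong (λ t → n * t + n * k * p * B + c′ * k * A) absA ⟩
    n * (n * p * A) + n * k * p * B + c′ * k * A
      ≤⟨ +-mono-≤ (+-mono-≤ use-ih (*-monoʳ-≤ (n * k * p) B≤A)) (*-monoˡ-≤ A (*-monoˡ-≤ k k+c≤n)) ⟩
    n * p * (n * B + c * A) + n * k * p * A + n * k * A
      ≡⟨ solve 6 (λ n p k c A B → n :* p :* (n :* B :+ c :* A) :+ n :* k :* p :* A :+ n :* k :* A
           := n :* (n :* p :* B) :+ (k :+ c) :* (n :* p :* A) :+ n :* k :* A) refl n p k c A B ⟩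
    n * (n * p * B) + c′ * (n * p * A) + n * k * A
      ≡⟨ cong₂ (λ s t → n * s + c′ * t + n * k * A) absB absA ⟨
    n * (suc k * B′ + k * p * B) + c′ * (suc k * A′ + k * A) + n * k * A
      ≡⟨ solve 8 (λ k n p A A′ B B′ c′ → n :* ((con 1 :+ k) :* B′ :+ k :* p :* B) :+ c′ :* ((con 1 :+ k) :* A′ :+ k :* A) :+ n :* k :* A
           := (con 1 :+ k) :* (n :* B′ :+ c′ :* A′) :+ (n :* k :* A :+ n :* k :* p :* B :+ c′ :* k :* A)) refl k n p A A′ B B′ c′ ⟩
    suc k * (n * B′ + c′ * A′) + X ∎))
  where
  open ≤-Reasoning
  B  = p ^ k * S
  B′ = p ^ suc k * S′
  c′ = k + c
  X  = n * k * A + n * k * p * B + c′ * k * A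
  absB : suc k * B′ + k * p * B ≡ n * p * B
  absB = begin-equality
    suc k * (p * p ^ k * S′) + k * p * (p ^ k * S)
      ≡⟨ solve 5 (λ k p q S S′ → (con 1 :+ k) :* (p :* q :* S′) :+ k :* p :* (q :* S)
           := p :* q :* ((con 1 :+ k) :* S′ :+ k :* S)) refl k p (p ^ k) S S′ ⟩
    p * p ^ k * (suc k * S′ + k * S)
      ≡⟨ cong (p * p ^ k *_) absS ⟩
    p * p ^ k * (n * S)
      ≡⟨ solve 4 (λ n p q S → p :* q :* (n :* S) := n :* p :* (q :* S)) refl n p (p ^ k) S ⟩
    n * p * B ∎
  use-ih : n * (n * p * A) ≤ n * p * (n * B + c * A)
  use-ih = begin
    n * (n * p * A) ≡⟨ solve 3 (λ n p A → n :* (n :* p :* A) := n :* p :* (n :* A)) refl n p A ⟩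
    n * p * (n * A) ≤⟨ *-monoʳ-≤ (n * p) ih ⟩
    n * p * (n * B + c * A) ∎

binomial-defect : ∀ n p → (∀ k → p ^ k * binom n k ≤ binom (n * p) k) →
  ∀ k → n * binom (n * p) k ≤ n * (p ^ k * binom n k) + binom k 2 * binom (n * p) k
binomial-defect n p lower zero = ≤-reflexive (sym (+-identityʳ _))
binomial-defect n p lower (suc k) rewrite binom-1 k with n ≤? k + binom k 2
... | yes n≤c = ≤-trans (*-monoˡ-≤ _ n≤c) (m≤n+m _ _)
... | no  n≰c = defect-step n p k (binom k 2) (<⇒≤ (≰⇒> n≰c))
  (binom-absorption (n * p) k) (binom-absorption n k) (binomial-defect n p lower k) (lower k)

module Blocks (n p : ℕ) where

  block : Fin n → List (Fin (n * p))
  block b = tabulate (combine b)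

  blocksOf : List (Fin n) → List (Fin (n * p))
  blocksOf = concatMap block

  allFin-blocks : allFin (n * p) ≡ concat (tabulate block)
  allFin-blocks = tabulate-combine n p (λ i → i)

  allFin-blocksOf : allFin (n * p) ≡ blocksOf (allFin n)
  allFin-blocksOf = trans allFin-blocks (cong concat (sym (Listₚ.map-tabulate (λ i → i) block)))

  count-in-block : ∀ {k} (Q : Vec (Fin p) k → Bool) (Q₃ : Vec (Fin (n * p)) k → Bool) →
    (∀ b rs → Q₃ (Vec.map (combine b) rs) ≡ Q rs) → ∀ b →
    countᵇ Q₃ (choose k (block b)) ≡ countᵇ Q (choose k (allFin p))
  count-in-block {k} Q Q₃ local b = begin
    countᵇ Q₃ (choose k (tabulate (combine b)))
      ≡⟨ cong (countᵇ Q₃ ∘ choose k) (Listₚ.map-tabulate (λ i → i) (combine b)) ⟨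
    countᵇ Q₃ (choose k (List.map (combine b) (allFin p)))
      ≡⟨ cong (countᵇ Q₃) (choose-map (combine b) k (allFin p)) ⟩
    countᵇ Q₃ (List.map (Vec.map (combine b)) (choose k (allFin p)))
      ≡⟨ count-map Q₃ (Vec.map (combine b)) (choose k (allFin p)) ⟩
    countᵇ (Q₃ ∘ Vec.map (combine b)) (choose k (allFin p))
      ≡⟨ count-cong (local b) (choose k (allFin p)) ⟩
    countᵇ Q (choose k (allFin p)) ∎
    where open ≡-Reasoning

  count-within-blocks : ∀ {k} (Q : Vec (Fin p) (suc k) → Bool) (Q₃ : Vec (Fin (n * p)) (suc k) → Bool) →
    (∀ b rs → Q₃ (Vec.map (combine b) rs) ≡ Q rs) →
    n * countᵇ Q (choose (suc k) (allFin p)) ≤ countᵇ Q₃ (choose (suc k) (allFin (n * p)))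
  count-within-blocks {k} Q Q₃ local =
    subst (λ L → n * countᵇ Q (choose (suc k) (allFin p)) ≤ countᵇ Q₃ (choose (suc k) L))
      (sym allFin-blocks)
      (count-choose-concat k Q₃ block _ (λ b → ≤-reflexive (sym (count-in-block Q Q₃ local b))))

  -- Index sets meeting k distinct blocks: choosing k distinct blocks and then
  -- one position in each gives p^k index sets per k-set of blocks.
  AgreesOnDistinct : ∀ {k} → List (Fin n) → (Vec (Fin n) k → Bool) → (Vec (Fin (n * p)) k → Bool) → Set
  AgreesOnDistinct xs Q Q₃ = ∀ bs rs → VecAll.All (_∈ xs) bs → VecUnique bs →
    Q₃ (Vec.zipWith combine bs rs) ≡ Q bs

  count-across-blocks : ∀ k xs → ListUnique xs →
    (Q : Vec (Fin n) k → Bool) (Q₃ : Vec (Fin (n * p)) k → Bool) → AgreesOnDistinct xs Q Q₃ →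
    p ^ k * countᵇ Q (choose k xs) ≤ countᵇ Q₃ (choose k (blocksOf xs))
  count-across-blocks zero xs _ Q Q₃ agree rewrite agree [] [] VecAll.[] [] =
    ≤-reflexive (*-identityˡ _)
  count-across-blocks (suc k) [] _ Q Q₃ agree rewrite *-zeroʳ (p ^ suc k) = z≤n
  count-across-blocks (suc k) (x ∷ xs) (x∉xs ∷ unique) Q Q₃ agree = begin
    p ^ suc k * countᵇ Q (choose (suc k) (x ∷ xs))
      ≡⟨ cong (p ^ suc k *_) (count-choose-∷ k Q x xs) ⟩
    p ^ suc k * (countᵇ Q-x (choose k xs) + countᵇ Q (choose (suc k) xs))
      ≡⟨ *-distribˡ-+ (p ^ suc k) _ _ ⟩
    p * p ^ k * countᵇ Q-x (choose k xs) + p ^ suc k * countᵇ Q (choose (suc k) xs)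
      ≡⟨ cong (_+ p ^ suc k * countᵇ Q (choose (suc k) xs)) (*-assoc p (p ^ k) _) ⟩
    p * (p ^ k * countᵇ Q-x (choose k xs)) + p ^ suc k * countᵇ Q (choose (suc k) xs)
      ≤⟨ +-monoʳ-≤ (p * _) (count-across-blocks (suc k) xs unique Q Q₃
           (λ bs rs bs⊆xs → agree bs rs (VecAll.map there bs⊆xs))) ⟩
    p * (p ^ k * countᵇ Q-x (choose k xs)) + countᵇ Q₃ (choose (suc k) (blocksOf xs))
      ≤⟨ count-choose-prefix k Q₃ (combine x) (blocksOf xs) _
           (λ r → count-across-blocks k xs unique Q-x (λ v → Q₃ (combine x r ∷ v)) (agree-x r)) ⟩
    countᵇ Q₃ (choose (suc k) (blocksOf (x ∷ xs))) ∎
    where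
    open ≤-Reasoning
    Q-x : Vec (Fin n) k → Bool
    Q-x bs = Q (x ∷ bs)
    agree-x : ∀ r → AgreesOnDistinct xs Q-x (λ v → Q₃ (combine x r ∷ v))
    agree-x r bs rs bs⊆xs u = agree (x ∷ bs) (r ∷ rs) (here refl VecAll.∷ VecAll.map there bs⊆xs)
      (VecAll.map (λ y∈xs → ListAll.lookup x∉xs y∈xs) bs⊆xs ∷ u)

  count-distinct-blocks : ∀ {k} (Q : Vec (Fin n) k → Bool) (Q₃ : Vec (Fin (n * p)) k → Bool) →
    (∀ bs rs → VecUnique bs → Q₃ (Vec.zipWith combine bs rs) ≡ Q bs) →
    p ^ k * countᵇ Q (choose k (allFin n)) ≤ countᵇ Q₃ (choose k (allFin (n * p)))
  count-distinct-blocks {k} Q Q₃ agree =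
    subst (λ L → p ^ k * countᵇ Q (choose k (allFin n)) ≤ countᵇ Q₃ (choose k L))
      (sym allFin-blocksOf)
      (count-across-blocks k (allFin n) (allFin⁺ n) Q Q₃ (λ bs rs _ → agree bs rs))

<ᵇ-true : ∀ {m n} → m < n → (m <ᵇ n) ≡ true
<ᵇ-true {zero}  {suc n} _         = refl
<ᵇ-true {suc m} {suc n} (s≤s m<n) = <ᵇ-true m<n

<ᵇ-false : ∀ {m n} → n ≤ m → (m <ᵇ n) ≡ false
<ᵇ-false {m}     {zero}  _         = refl
<ᵇ-false {suc m} {suc n} (s≤s n≤m) = <ᵇ-false n≤m

<ᵇ-irrefl : ∀ m → (m <ᵇ m) ≡ false
<ᵇ-irrefl m = <ᵇ-false {m} ≤-refl

<ᵇ-cancelˡ-+ : ∀ a x y → (a + x <ᵇ a + y) ≡ (x <ᵇ y)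
<ᵇ-cancelˡ-+ zero    x y = refl
<ᵇ-cancelˡ-+ (suc a) x y = <ᵇ-cancelˡ-+ a x y

≡ᵇ-cancelˡ-+ : ∀ a x y → (a + x ≡ᵇ a + y) ≡ (x ≡ᵇ y)
≡ᵇ-cancelˡ-+ zero    x y = refl
≡ᵇ-cancelˡ-+ (suc a) x y = ≡ᵇ-cancelˡ-+ a x y

combine-<ᵇ-same : ∀ {n p} (c : Fin n) (x y : Fin p) →
  (toℕ (combine c x) <ᵇ toℕ (combine c y)) ≡ (toℕ x <ᵇ toℕ y)
combine-<ᵇ-same {p = p} c x y rewrite toℕ-combine c x | toℕ-combine c y =
  <ᵇ-cancelˡ-+ (p * toℕ c) (toℕ x) (toℕ y)

combine-<ᵇ-distinct : ∀ {n p} (c c′ : Fin n) (x y : Fin p) → c ≢ c′ →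
  (toℕ (combine c x) <ᵇ toℕ (combine c′ y)) ≡ (toℕ c <ᵇ toℕ c′)
combine-<ᵇ-distinct c c′ x y c≢c′ with <-cmp (toℕ c) (toℕ c′)
... | tri< c<c′ _ _ = trans (<ᵇ-true (combine-monoˡ-< x y c<c′)) (sym (<ᵇ-true c<c′))
... | tri≈ _ c≡c′ _ = ⊥-elim (c≢c′ (toℕ-injective c≡c′))
... | tri> _ _ c′<c = trans (<ᵇ-false (<⇒≤ (combine-monoˡ-< y x c′<c))) (sym (<ᵇ-false (<⇒≤ c′<c)))

at-injective : ∀ {m} (ρ : Permutation′ m) {i j} → ρ at i ≡ ρ at j → i ≡ j
at-injective ρ {i} {j} e = trans (sym (inverseˡ ρ)) (trans (cong (ρ ⟨$⟩ˡ_) e) (inverseˡ ρ))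

allᵇ-cong : ∀ {A : Set} {f g : A → Bool} → (∀ x → f x ≡ g x) → ∀ xs → allᵇ f xs ≡ allᵇ g xs
allᵇ-cong f≗g []       = refl
allᵇ-cong f≗g (x ∷ xs) = cong₂ _∧_ (f≗g x) (allᵇ-cong f≗g xs)

isOcc-cong : ∀ {k n m} (π : Permutation′ k) (σ : Permutation′ n) (σ′ : Permutation′ m) is is′ →
  (∀ a b → (toℕ (σ at lookup is a) <ᵇ toℕ (σ at lookup is b))
         ≡ (toℕ (σ′ at lookup is′ a) <ᵇ toℕ (σ′ at lookup is′ b))) →
  isOccᵇ π σ is ≡ isOccᵇ π σ′ is′
isOcc-cong {k} π σ σ′ is is′ same =
  allᵇ-cong (λ a → allᵇ-cong (λ b → cong ((toℕ (π at a) <ᵇ toℕ (π at b)) ==ᵇ_) (same a b)) (allFin k)) (allFin k)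

module Inflation {n p : ℕ} (σ : Permutation′ n) (τ : Permutation′ p) where

  σ[τ] : Permutation′ (n * p)
  σ[τ] = proj₂ (inflate (n , σ) (p , τ))

  inflate-at : ∀ b r → σ[τ] at combine b r ≡ combine (σ at b) (τ at r)
  inflate-at b r = cong (λ q → combine (σ at proj₁ q) (τ at proj₂ q)) (remQuot-combine b r)

  occ-in-block : ∀ {k} (π : Permutation′ k) (b : Fin n) (rs : Vec (Fin p) k) →
    isOccᵇ π σ[τ] (Vec.map (combine b) rs) ≡ isOccᵇ π τ rs
  occ-in-block π b rs = isOcc-cong π σ[τ] τ (Vec.map (combine b) rs) rs λ a c →
    begin
      (toℕ (σ[τ] at lookup (Vec.map (combine b) rs) a) <ᵇ toℕ (σ[τ] at lookup (Vec.map (combine b) rs) c))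
        ≡⟨ cong₂ (λ i j → toℕ (σ[τ] at i) <ᵇ toℕ (σ[τ] at j))
                 (Vecₚ.lookup-map a (combine b) rs) (Vecₚ.lookup-map c (combine b) rs) ⟩
      (toℕ (σ[τ] at combine b (lookup rs a)) <ᵇ toℕ (σ[τ] at combine b (lookup rs c)))
        ≡⟨ cong₂ (λ i j → toℕ i <ᵇ toℕ j) (inflate-at b (lookup rs a)) (inflate-at b (lookup rs c)) ⟩
      (toℕ (combine (σ at b) (τ at lookup rs a)) <ᵇ toℕ (combine (σ at b) (τ at lookup rs c)))
        ≡⟨ combine-<ᵇ-same (σ at b) _ _ ⟩
      (toℕ (τ at lookup rs a) <ᵇ toℕ (τ at lookup rs c)) ∎
    where open ≡-Reasoning

  occ-across-blocks : ∀ {k} (π : Permutation′ k) (bs : Vec (Fin n) k) (rs : Vec (Fin p) k) →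
    VecUnique bs → isOccᵇ π σ[τ] (Vec.zipWith combine bs rs) ≡ isOccᵇ π σ bs
  occ-across-blocks π bs rs unique = isOcc-cong π σ[τ] σ (Vec.zipWith combine bs rs) bs λ a c →
    begin
      (toℕ (σ[τ] at lookup (Vec.zipWith combine bs rs) a) <ᵇ toℕ (σ[τ] at lookup (Vec.zipWith combine bs rs) c))
        ≡⟨ cong₂ (λ i j → toℕ (σ[τ] at i) <ᵇ toℕ (σ[τ] at j))
                 (Vecₚ.lookup-zipWith combine a bs rs) (Vecₚ.lookup-zipWith combine c bs rs) ⟩
      (toℕ (σ[τ] at combine (lookup bs a) (lookup rs a)) <ᵇ toℕ (σ[τ] at combine (lookup bs c) (lookup rs c)))
        ≡⟨ cong₂ (λ i j → toℕ i <ᵇ toℕ j) (inflate-at _ _) (inflate-at _ _) ⟩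
      (toℕ (combine (σ at lookup bs a) (τ at lookup rs a)) <ᵇ toℕ (combine (σ at lookup bs c) (τ at lookup rs c)))
        ≡⟨ compare a c ⟩
      (toℕ (σ at lookup bs a) <ᵇ toℕ (σ at lookup bs c)) ∎
    where
    open ≡-Reasoning
    -- equal indices compare as false on both sides; distinct ones lie in distinct blocks
    compare : ∀ a c →
      (toℕ (combine (σ at lookup bs a) (τ at lookup rs a)) <ᵇ toℕ (combine (σ at lookup bs c) (τ at lookup rs c)))
      ≡ (toℕ (σ at lookup bs a) <ᵇ toℕ (σ at lookup bs c))
    compare a c with a Fin.≟ c
    ... | yes refl = trans (<ᵇ-irrefl (toℕ (combine (σ at lookup bs a) (τ at lookup rs a))))
                           (sym (<ᵇ-irrefl (toℕ (σ at lookup bs a))))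
    ... | no  a≢c  = combine-<ᵇ-distinct _ _ _ _
      (λ e → a≢c (VecUniqueₚ.lookup-injective unique a c (at-injective σ e)))

  consecutive-in-block : ∀ {k} (b : Fin n) (rs : Vec (Fin p) k) →
    consecutiveᵇ (Vec.map (combine b) rs) ≡ consecutiveᵇ rs
  consecutive-in-block b []           = refl
  consecutive-in-block b (i ∷ [])     = refl
  consecutive-in-block b (i ∷ j ∷ is) = cong₂ _∧_ successor (consecutive-in-block b (j ∷ is))
    where
    successor : (suc (toℕ (combine b i)) ≡ᵇ toℕ (combine b j)) ≡ (suc (toℕ i) ≡ᵇ toℕ j)
    successor rewrite toℕ-combine b i | toℕ-combine b j | sym (+-suc (p * toℕ b) (toℕ i)) =
      ≡ᵇ-cancelˡ-+ (p * toℕ b) _ _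

Run : ∀ {N} → ℕ → List (Fin N) → Set
Run v []       = ⊤
Run v (x ∷ xs) = toℕ x ≡ v × Run (suc v) xs

run-tail : ∀ {N v} {x : Fin N} {xs : List (Fin N)} → toℕ x ≡ v → Run (suc v) xs → Run (suc (toℕ x)) xs
run-tail {xs = xs} x≡v = subst (λ w → Run (suc w) xs) (sym x≡v)

run-tabulate : ∀ {N m} v (f : Fin m → Fin N) → (∀ i → toℕ (f i) ≡ v + toℕ i) → Run v (tabulate f)
run-tabulate {m = zero}  v f shift = tt
run-tabulate {m = suc m} v f shift = trans (shift Fin.zero) (+-identityʳ v) ,
  run-tabulate (suc v) (f ∘ Fin.suc) (λ i → trans (shift (Fin.suc i)) (+-suc v (toℕ i)))

run-allFin : ∀ N → Run 0 (allFin N)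
run-allFin N = run-tabulate 0 (λ i → i) (λ i → refl)

≡ᵇ-refl : ∀ n → (n ≡ᵇ n) ≡ true
≡ᵇ-refl zero    = refl
≡ᵇ-refl (suc n) = ≡ᵇ-refl n

≡ᵇ-false : ∀ {m n} → m ≢ n → (m ≡ᵇ n) ≡ false
≡ᵇ-false {zero}  {zero}  m≢n = ⊥-elim (m≢n refl)
≡ᵇ-false {zero}  {suc n} m≢n = refl
≡ᵇ-false {suc m} {zero}  m≢n = refl
≡ᵇ-false {suc m} {suc n} m≢n = ≡ᵇ-false (m≢n ∘ cong suc)

module Windows {N : ℕ} where

  extends : ∀ {k} → Fin N → Vec (Fin N) k → Bool
  extends x ys = consecutiveᵇ (x ∷ ys)

  extends-next : ∀ {k} x y (v : Vec (Fin N) k) → toℕ y ≡ suc (toℕ x) → extends x (y ∷ v) ≡ extends y v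
  extends-next x y v y≡x+1 =
    cong (_∧ consecutiveᵇ (y ∷ v)) (trans (cong (suc (toℕ x) ≡ᵇ_) y≡x+1) (≡ᵇ-refl (suc (toℕ x))))

  extends-none : ∀ k w (xs : List (Fin N)) x → Run w xs → suc (toℕ x) < w →
    countᵇ (extends x) (choose (suc k) xs) ≡ 0
  extends-none k w []       x run       gap = refl
  extends-none k w (z ∷ zs) x (z≡w , run) gap = trans (count-choose-∷ k (extends x) z zs)
    (cong₂ _+_ (count-none not-next (choose k zs)) (extends-none k (suc w) zs x run (m<n⇒m<1+n gap)))
    where
    not-next : ∀ (v : Vec (Fin N) k) → extends x (z ∷ v) ≡ false
    not-next v = cong (_∧ consecutiveᵇ (z ∷ v))
      (≡ᵇ-false {suc (toℕ x)} {toℕ z} (λ e → <⇒≢ gap (trans e z≡w)))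

  extends-at-most-one : ∀ k (xs : List (Fin N)) x → Run (suc (toℕ x)) xs →
    countᵇ (extends x) (choose k xs) ≤ 1
  extends-at-most-one zero    xs       x run = ≤-refl
  extends-at-most-one (suc k) []       x run = z≤n
  extends-at-most-one (suc k) (y ∷ ys) x (y≡x+1 , run) = begin
    countᵇ (extends x) (choose (suc k) (y ∷ ys))
      ≡⟨ count-choose-∷ k (extends x) y ys ⟩
    countᵇ (λ v → extends x (y ∷ v)) (choose k ys) + countᵇ (extends x) (choose (suc k) ys)
      ≡⟨ cong₂ _+_ (count-cong (λ v → extends-next x y v y≡x+1) (choose k ys))
                   (extends-none k (suc (suc (toℕ x))) ys x run ≤-refl) ⟩
    countᵇ (extends y) (choose k ys) + 0
      ≡⟨ +-identityʳ _ ⟩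
    countᵇ (extends y) (choose k ys)
      ≤⟨ extends-at-most-one k ys y (run-tail y≡x+1 run) ⟩
    1 ∎
    where open ≤-Reasoning

  extends-at-least-one : ∀ k (xs : List (Fin N)) x → Run (suc (toℕ x)) xs → k ≤ length xs →
    1 ≤ countᵇ (extends x) (choose k xs)
  extends-at-least-one zero    xs       x run le = ≤-refl
  extends-at-least-one (suc k) (y ∷ ys) x (y≡x+1 , run) (s≤s le) = begin
    1
      ≤⟨ extends-at-least-one k ys y (run-tail y≡x+1 run) le ⟩
    countᵇ (extends y) (choose k ys)
      ≡⟨ count-cong (λ v → extends-next x y v y≡x+1) (choose k ys) ⟨
    countᵇ (λ v → extends x (y ∷ v)) (choose k ys)
      ≤⟨ m≤m+n _ _ ⟩
    countᵇ (λ v → extends x (y ∷ v)) (choose k ys) + countᵇ (extends x) (choose (suc k) ys)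
      ≡⟨ count-choose-∷ k (extends x) y ys ⟨
    countᵇ (extends x) (choose (suc k) (y ∷ ys)) ∎
    where open ≤-Reasoning

  -- every window of a run starts at a distinct element
  windows-upper : ∀ k v (xs : List (Fin N)) → Run v xs →
    countᵇ consecutiveᵇ (choose (suc k) xs) ≤ length xs
  windows-upper k v []       run = z≤n
  windows-upper k v (x ∷ xs) (x≡v , run) = begin
    countᵇ consecutiveᵇ (choose (suc k) (x ∷ xs))
      ≡⟨ count-choose-∷ k consecutiveᵇ x xs ⟩
    countᵇ (extends x) (choose k xs) + countᵇ consecutiveᵇ (choose (suc k) xs)
      ≤⟨ +-mono-≤ (extends-at-most-one k xs x (run-tail x≡v run))
                  (windows-upper k (suc v) xs run) ⟩
    suc (length xs) ∎
    where open ≤-Reasoning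

  -- every element except the last k starts a window
  windows-lower : ∀ k v (xs : List (Fin N)) → Run v xs →
    length xs ≤ countᵇ consecutiveᵇ (choose (suc k) xs) + k
  windows-lower k v []       run = z≤n
  windows-lower k v (x ∷ xs) (x≡v , run) with k ≤? length xs
  ... | no  k≰xs = ≤-trans (≰⇒> k≰xs) (m≤n+m k _)
  ... | yes k≤xs = begin
    suc (length xs)
      ≤⟨ +-mono-≤ (extends-at-least-one k xs x (run-tail x≡v run) k≤xs) (windows-lower k (suc v) xs run) ⟩
    countᵇ (extends x) (choose k xs) + (countᵇ consecutiveᵇ (choose (suc k) xs) + k)
      ≡⟨ +-assoc (countᵇ (extends x) (choose k xs)) _ k ⟨
    countᵇ (extends x) (choose k xs) + countᵇ consecutiveᵇ (choose (suc k) xs) + k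
      ≡⟨ cong (_+ k) (count-choose-∷ k consecutiveᵇ x xs) ⟨
    countᵇ consecutiveᵇ (choose (suc k) (x ∷ xs)) + k ∎
    where open ≤-Reasoning

length-allFin : ∀ N → length (allFin N) ≡ N
length-allFin N = Listₚ.length-tabulate (λ i → i)

length-indexSets : ∀ k N → length (indexSets k N) ≡ binom N k
length-indexSets k N = trans (length-choose k (allFin N)) (cong (λ x → binom x k) (length-allFin N))

module InflationCounts {n p : ℕ} (σ : Permutation′ n) (τ : Permutation′ p) where
  open Inflation σ τ
  open Blocks n p
  open Windows

  σ₃ : Perm
  σ₃ = inflate (n , σ) (p , τ)

  -- Consecutive occurrences: every window inside a block of σ[τ] is a
  -- window of τ, so the blocks contain n copies of the occurrences and of the
  -- non-occurrences of τ; as σ[τ] has at most n·p windows and τ at least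
  -- p - k, at most n·k windows of σ[τ] are left over.
  module _ {k : ℕ} (π : Permutation′ (suc k)) where

    c-occ-lower : n * c-occ π (p , τ) ≤ c-occ π σ₃
    c-occ-lower = count-within-blocks (λ is → isOccᵇ π τ is ∧ consecutiveᵇ is)
      (λ is → isOccᵇ π σ[τ] is ∧ consecutiveᵇ is)
      (λ b rs → cong₂ _∧_ (occ-in-block π b rs) (consecutive-in-block b rs))

    c-occ-upper : c-occ π σ₃ ≤ n * c-occ π (p , τ) + n * k
    c-occ-upper = +-cancelʳ-≤ (n * nonτ) _ _ (begin
      c-occ π σ₃ + n * nonτ
        ≤⟨ +-monoʳ-≤ (c-occ π σ₃) non-lower ⟩
      c-occ π σ₃ + non₃
        ≡⟨ count-split (isOccᵇ π σ[τ]) consecutiveᵇ (indexSets (suc k) (n * p)) ⟩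
      countᵇ consecutiveᵇ (indexSets (suc k) (n * p))
        ≤⟨ windows-upper k 0 (allFin (n * p)) (run-allFin (n * p)) ⟩
      length (allFin (n * p))
        ≡⟨ length-allFin (n * p) ⟩
      n * p
        ≤⟨ *-monoʳ-≤ n (subst (_≤ windowsτ + k) (length-allFin p) (windows-lower k 0 (allFin p) (run-allFin p))) ⟩
      n * (windowsτ + k)
        ≡⟨ cong (λ w → n * (w + k)) (count-split (isOccᵇ π τ) consecutiveᵇ (indexSets (suc k) p)) ⟨
      n * (c-occ π (p , τ) + nonτ + k)
        ≡⟨ solve 4 (λ n a b c → n :* (a :+ b :+ c) := n :* a :+ n :* c :+ n :* b) refl n (c-occ π (p , τ)) nonτ k ⟩
      n * c-occ π (p , τ) + n * k + n * nonτ ∎)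
      where
      open ≤-Reasoning
      non₃ nonτ windowsτ : ℕ
      non₃     = countᵇ (λ is → not (isOccᵇ π σ[τ] is) ∧ consecutiveᵇ is) (indexSets (suc k) (n * p))
      nonτ     = countᵇ (λ is → not (isOccᵇ π τ is) ∧ consecutiveᵇ is) (indexSets (suc k) p)
      windowsτ = countᵇ consecutiveᵇ (indexSets (suc k) p)
      non-lower : n * nonτ ≤ non₃
      non-lower = count-within-blocks (λ is → not (isOccᵇ π τ is) ∧ consecutiveᵇ is)
        (λ is → not (isOccᵇ π σ[τ] is) ∧ consecutiveᵇ is)
        (λ b rs → cong₂ _∧_ (cong not (occ-in-block π b rs)) (consecutive-in-block b rs))

  -- Classical occurrences: each occurrence (resp. non-occurrence) of π in σ
  -- yields p^k occurrences (resp. non-occurrences) in σ[τ] across blocks.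
  module _ {k : ℕ} (π : Permutation′ k) where

    non-occ : Perm → ℕ
    non-occ (m , ρ) = countᵇ (not ∘ isOccᵇ π ρ) (indexSets k m)

    occ-lower : p ^ k * occ π (n , σ) ≤ occ π σ₃
    occ-lower = count-distinct-blocks (isOccᵇ π σ) (isOccᵇ π σ[τ]) (occ-across-blocks π)

    non-occ-lower : p ^ k * non-occ (n , σ) ≤ non-occ σ₃
    non-occ-lower = count-distinct-blocks (not ∘ isOccᵇ π σ) (not ∘ isOccᵇ π σ[τ])
      (λ bs rs u → cong not (occ-across-blocks π bs rs u))

    occ+non-occ : ∀ S → occ π S + non-occ S ≡ size S C k
    occ+non-occ (m , ρ) = trans (count-not (isOccᵇ π ρ) (indexSets k m))
      (trans (length-indexSets k m) (binom≡C m k))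

  -- Choosing k distinct blocks and a position in each: p^k·C(n,k) ≤ C(np,k).
  binom-lower : ∀ k → p ^ k * binom n k ≤ binom (n * p) k
  binom-lower k = subst₂ (λ a b → p ^ k * a ≤ b)
    (trans (count-all (indexSets k n)) (length-indexSets k n))
    (trans (count-all (indexSets k (n * p))) (length-indexSets k (n * p)))
    (count-distinct-blocks {k} (λ _ → true) (λ _ → true) (λ _ _ _ → refl))

ℤ-sub-≤ : ∀ x y z → x ≤ y + z → + x ℤ.- + y ℤ.≤ + z
ℤ-sub-≤ x y z x≤y+z rewrite ℤₚ.m-n≡m⊖n x y with ≤-total y x
... | inj₁ y≤x rewrite ℤₚ.≤-⊖ y≤x =
  ℤ.+≤+ (≤-trans (∸-monoˡ-≤ y x≤y+z) (≤-reflexive (m+n∸m≡n y z)))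
... | inj₂ x≤y rewrite ℤₚ.⊖-≤ x≤y = ℤₚ.neg-≤-pos

ratio-diff-≤ : ∀ a b c d e f → 1 ≤ b → 1 ≤ d → 1 ≤ f →
  a * d * f ≤ c * b * f + e * b * d → ratio a b - ratio c d ℚ.≤ ratio e f
ratio-diff-≤ a (suc b) c (suc d) e (suc f) _ _ _ cross =
  ℚₚ.toℚᵘ-cancel-≤ (ℚᵘₚ.≤-respˡ-≃ (ℚᵘₚ.≃-sym lhs) (ℚᵘₚ.≤-respʳ-≃ (ℚᵘₚ.≃-sym (ℚₚ.toℚᵘ-fromℚᵘ w)) core))
  where
  module ℤS = Data.Integer.Solver.+-*-Solver
  u = mkℚᵘ (+ a) b
  v = mkℚᵘ (+ c) d
  w = mkℚᵘ (+ e) f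
  lhs : toℚᵘ (ratio a (suc b) - ratio c (suc d)) ℚᵘ.≃ u ℚᵘ.+ ℚᵘ.- v
  lhs = ℚᵘₚ.≃-trans (ℚₚ.toℚᵘ-homo-+ (ratio a (suc b)) (ℚ.- ratio c (suc d)))
    (ℚᵘₚ.+-cong (ℚₚ.toℚᵘ-fromℚᵘ u)
                (ℚᵘₚ.≃-trans (ℚₚ.toℚᵘ-homo‿- (ratio c (suc d))) (ℚᵘₚ.-‿cong (ℚₚ.toℚᵘ-fromℚᵘ v))))
  numerator : (+ a ℤ.* + suc d ℤ.+ ℤ.- (+ c) ℤ.* + suc b) ℤ.* + suc f
            ≡ + (a * suc d * suc f) ℤ.- + (c * suc b * suc f)
  numerator = begin
    (+ a ℤ.* + suc d ℤ.+ ℤ.- (+ c) ℤ.* + suc b) ℤ.* + suc f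
      ≡⟨ ℤS.solve 5 (λ a c sb sd sf → (a ℤS.:* sd ℤS.:+ ℤS.:- c ℤS.:* sb) ℤS.:* sf
           ℤS.:= a ℤS.:* sd ℤS.:* sf ℤS.:- c ℤS.:* sb ℤS.:* sf) refl (+ a) (+ c) (+ suc b) (+ suc d) (+ suc f) ⟩
    + a ℤ.* + suc d ℤ.* + suc f ℤ.- + c ℤ.* + suc b ℤ.* + suc f
      ≡⟨ cong₂ ℤ._-_ (trans (cong (ℤ._* + suc f) (sym (ℤₚ.pos-* a (suc d)))) (sym (ℤₚ.pos-* (a * suc d) (suc f))))
                     (trans (cong (ℤ._* + suc f) (sym (ℤₚ.pos-* c (suc b)))) (sym (ℤₚ.pos-* (c * suc b) (suc f)))) ⟩
    + (a * suc d * suc f) ℤ.- + (c * suc b * suc f) ∎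
    where open ≡-Reasoning
  denominator : + e ℤ.* + (suc b * suc d) ≡ + (e * suc b * suc d)
  denominator = trans (sym (ℤₚ.pos-* e (suc b * suc d))) (cong +_ (sym (*-assoc e (suc b) (suc d))))
  core : u ℚᵘ.+ ℚᵘ.- v ℚᵘ.≤ w
  core = *≤* (subst₂ ℤ._≤_ (sym numerator) (sym denominator) (ℤ-sub-≤ _ _ _ cross))

∣-∣-≤ : ∀ x y e → x - y ℚ.≤ e → y - x ℚ.≤ e → ∣ x - y ∣ ℚ.≤ e
∣-∣-≤ x y e x-y≤e y-x≤e with ℚₚ.∣p∣≡p∨∣p∣≡-p (x - y)
... | inj₁ eq = subst (ℚ._≤ e) (sym eq) x-y≤e
... | inj₂ eq = subst (ℚ._≤ e) (sym (trans eq (QS.solve 2 (λ x y → QS.:- (x QS.:- y) QS.:= y QS.:- x) refl x y))) y-x≤e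
  where module QS = Data.Rational.Solver.+-*-Solver

ratio-small : ∀ K ε → 0ℚ ℚ.< ε → ∃ λ B → ∀ N → B ≤ N → ratio K N ℚ.≤ ε
ratio-small K (mkℚ (+ zero)  d _) (ℚ.*<* (ℤ.+<+ ()))
ratio-small K (mkℚ -[1+ _ ]  d _) (ℚ.*<* ())
ratio-small K (mkℚ (+ suc a) d _) _ = suc (K * suc d) , λ where
  (suc N) (s≤s KD≤N) → ℚₚ.toℚᵘ-cancel-≤ (ℚᵘₚ.≤-respˡ-≃ (ℚᵘₚ.≃-sym (ℚₚ.toℚᵘ-fromℚᵘ (mkℚᵘ (+ K) N)))
    (*≤* (subst₂ ℤ._≤_ (ℤₚ.pos-* K (suc d)) (ℤₚ.pos-* (suc a) (suc N))
      (ℤ.+≤+ (≤-trans (≤-trans KD≤N (n≤1+n N)) (m≤m+n (suc N) (a * suc N)))))))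

Eventually : (ℕ → Set) → Set
Eventually P = ∃ λ M → ∀ m → M ≤ m → P m

eventually-map : ∀ {P Q : ℕ → Set} → (∀ m → P m → Q m) → Eventually P → Eventually Q
eventually-map P⇒Q (M , P-from) = M , λ m M≤m → P⇒Q m (P-from m M≤m)

eventually-both : ∀ {P Q : ℕ → Set} → Eventually P → Eventually Q → Eventually (λ m → P m × Q m)
eventually-both (M , P-from) (M′ , Q-from) = M ⊔ M′ , λ m le →
  P-from m (≤-trans (m≤m⊔n M M′) le) , Q-from m (≤-trans (m≤n⊔m M M′) le)

Diverges : (ℕ → ℕ) → Set
Diverges N = ∀ B → Eventually (λ m → B ≤ N m)

limit-transfer : ∀ (a b : ℕ → ℚ) x → b ⟶ x →
  (∀ ε → 0ℚ ℚ.< ε → Eventually (λ m → ∣ a m - b m ∣ ℚ.≤ ε)) → a ⟶ x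
limit-transfer a b x@(xs , _) b⟶x a≈b ε ε>0 =
  eventually-map close (eventually-both (b⟶x δ δ>0) (a≈b δ δ>0))
  where
  module QS = Data.Rational.Solver.+-*-Solver
  δ = ε ℚ.* ℚ.½
  δ>0 : 0ℚ ℚ.< δ
  δ>0 = ℚₚ.*-monoˡ-<-pos ℚ.½ ε>0
  close : ∀ m → dist≤ (b m) x δ × ∣ a m - b m ∣ ℚ.≤ δ → dist≤ (a m) x ε
  close m (b≈x , a≈b) i = begin
    ∣ a m - xs i ∣
      ≡⟨ cong ∣_∣ (QS.solve 3 (λ a b c → a QS.:- c QS.:= (a QS.:- b) QS.:+ (b QS.:- c)) refl (a m) (b m) (xs i)) ⟩
    ∣ (a m - b m) ℚ.+ (b m - xs i) ∣
      ≤⟨ ℚₚ.∣p+q∣≤∣p∣+∣q∣ (a m - b m) (b m - xs i) ⟩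
    ∣ a m - b m ∣ ℚ.+ ∣ b m - xs i ∣
      ≤⟨ ℚₚ.+-mono-≤ a≈b (b≈x i) ⟩
    δ ℚ.+ (δ ℚ.+ 1/[1+ i ])
      ≡⟨ QS.solve 2 (λ e t → e QS.:* QS.con ℚ.½ QS.:+ (e QS.:* QS.con ℚ.½ QS.:+ t) QS.:= e QS.:+ t) refl ε 1/[1+ i ] ⟩
    ε ℚ.+ 1/[1+ i ] ∎
    where open ℚₚ.≤-Reasoning

limit-transfer-rate : ∀ (a b : ℕ → ℚ) x (N : ℕ → ℕ) K → Diverges N →
  Eventually (λ m → ∣ a m - b m ∣ ℚ.≤ ratio K (N m)) → b ⟶ x → a ⟶ x
limit-transfer-rate a b x N K N→∞ rate b⟶x = limit-transfer a b x b⟶x λ ε ε>0 →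
  let (B , small) = ratio-small K ε ε>0 in
  eventually-map (λ m (a≈b , N-large) → ℚₚ.≤-trans a≈b (small (N m) N-large))
    (eventually-both rate (N→∞ B))

part-deficit : ∀ n q c {x x₃ t t₃} → q * x ≤ x₃ → x ≤ t → n * t₃ ≤ n * (q * t) + c * t₃ →
  x * t₃ * n ≤ x₃ * t * n + c * t * t₃
part-deficit n q c {x} {x₃} {t} {t₃} qx≤x₃ x≤t defect = begin
  x * t₃ * n                   ≡⟨ solve 3 (λ x t₃ n → x :* t₃ :* n := x :* (n :* t₃)) refl x t₃ n ⟩
  x * (n * t₃)                 ≤⟨ *-monoʳ-≤ x defect ⟩
  x * (n * (q * t) + c * t₃)   ≡⟨ solve 6 (λ x n q t c t₃ → x :* (n :* (q :* t) :+ c :* t₃)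
                                    := q :* x :* t :* n :+ c :* x :* t₃) refl x n q t c t₃ ⟩
  q * x * t * n + c * x * t₃   ≤⟨ +-mono-≤ (*-monoˡ-≤ n (*-monoˡ-≤ t qx≤x₃)) (*-monoˡ-≤ t₃ (*-monoʳ-≤ c x≤t)) ⟩
  x₃ * t * n + c * t * t₃      ∎
  where open ≤-Reasoning

-- the other direction follows by applying the first to the complement
part-excess : ∀ n q c {o u o₃ u₃ t t₃} → q * u ≤ u₃ → u ≤ t → n * t₃ ≤ n * (q * t) + c * t₃ →
  o + u ≡ t → o₃ + u₃ ≡ t₃ → o₃ * t * n ≤ o * t₃ * n + c * t₃ * t
part-excess n q c {o} {u} {o₃} {u₃} {t} {t₃} qu≤u₃ u≤t defect split split₃ =
  +-cancelʳ-≤ (u₃ * t * n) _ _ (begin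
    o₃ * t * n + u₃ * t * n        ≡⟨ solve 4 (λ a b t n → a :* t :* n :+ b :* t :* n := (a :+ b) :* t :* n) refl o₃ u₃ t n ⟩
    (o₃ + u₃) * t * n              ≡⟨ cong (λ s → s * t * n) split₃ ⟩
    t₃ * t * n                     ≡⟨ cong (λ s → t₃ * s * n) split ⟨
    t₃ * (o + u) * n               ≡⟨ solve 4 (λ t₃ o u n → t₃ :* (o :+ u) :* n := o :* t₃ :* n :+ u :* t₃ :* n) refl t₃ o u n ⟩
    o * t₃ * n + u * t₃ * n        ≤⟨ +-monoʳ-≤ (o * t₃ * n) (part-deficit n q c qu≤u₃ u≤t defect) ⟩
    o * t₃ * n + (u₃ * t * n + c * t * t₃)
      ≡⟨ solve 6 (λ a b c t t₃ n → a :+ (b :* t :* n :+ c :* t :* t₃) := a :+ c :* t₃ :* t :+ b :* t :* n)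
           refl (o * t₃ * n) u₃ c t t₃ n ⟩
    o * t₃ * n + c * t₃ * t + u₃ * t * n ∎)
  where open ≤-Reasoning

proportions-close : ∀ n q c {o u o₃ u₃ t t₃} → 1 ≤ n → 1 ≤ t → 1 ≤ t₃ →
  q * o ≤ o₃ → q * u ≤ u₃ → o + u ≡ t → o₃ + u₃ ≡ t₃ → n * t₃ ≤ n * (q * t) + c * t₃ →
  ∣ ratio o₃ t₃ - ratio o t ∣ ℚ.≤ ratio c n
proportions-close n q c {o} {u} {o₃} {u₃} {t} {t₃} 1≤n 1≤t 1≤t₃ qo≤o₃ qu≤u₃ split split₃ defect =
  ∣-∣-≤ (ratio o₃ t₃) (ratio o t) (ratio c n)
    (ratio-diff-≤ o₃ t₃ o t c n 1≤t₃ 1≤t 1≤n (part-excess n q c qu≤u₃ u≤t defect split split₃))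
    (ratio-diff-≤ o t o₃ t₃ c n 1≤t 1≤t₃ 1≤n (part-deficit n q c qo≤o₃ o≤t defect))
  where
  o≤t : o ≤ t
  o≤t = subst (o ≤_) split (m≤m+n o u)
  u≤t : u ≤ t
  u≤t = subst (u ≤_) split (m≤n+m u o)

≤-*-pos : ∀ n {p} → 1 ≤ p → n ≤ n * p
≤-*-pos n 1≤p = subst (_≤ n * _) (*-identityʳ n) (*-monoʳ-≤ n 1≤p)

c-occ~-inflate : ∀ {k} (π : Permutation′ (suc k)) S T → 1 ≤ size S → 1 ≤ size T →
  ∣ c-occ~ π (inflate S T) - c-occ~ π T ∣ ℚ.≤ ratio k (size T)
c-occ~-inflate {k} π (n , σ) (p , τ) 1≤n 1≤p = ∣-∣-≤ (ratio c₃ (n * p)) (ratio c p) (ratio k p)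
  (ratio-diff-≤ c₃ (n * p) c p k p 1≤np 1≤p 1≤p (begin
    c₃ * p * p               ≤⟨ *-monoˡ-≤ p (*-monoˡ-≤ p (c-occ-upper π)) ⟩
    (n * c + n * k) * p * p  ≡⟨ solve 4 (λ n c k p → (n :* c :+ n :* k) :* p :* p
                                  := c :* (n :* p) :* p :+ k :* (n :* p) :* p) refl n c k p ⟩
    c * (n * p) * p + k * (n * p) * p ∎))
  (ratio-diff-≤ c p c₃ (n * p) k p 1≤p 1≤np 1≤p (begin
    c * (n * p) * p          ≡⟨ solve 3 (λ n c p → c :* (n :* p) :* p := n :* c :* p :* p) refl n c p ⟩
    n * c * p * p            ≤⟨ *-monoˡ-≤ p (*-monoˡ-≤ p (c-occ-lower π)) ⟩
    c₃ * p * p               ≤⟨ m≤m+n _ _ ⟩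
    c₃ * p * p + k * p * (n * p) ∎))
  where
  open InflationCounts σ τ
  open ≤-Reasoning
  c₃ c : ℕ
  c₃ = c-occ π σ₃
  c  = c-occ π (p , τ)
  1≤np : 1 ≤ n * p
  1≤np = *-mono-≤ 1≤n 1≤p

occ~-inflate : ∀ {k} (π : Permutation′ k) S T → 1 ≤ size S → k ≤ size S → 1 ≤ size T →
  ∣ occ~ π (inflate S T) - occ~ π S ∣ ℚ.≤ ratio (binom k 2) (size S)
occ~-inflate {k} π (n , σ) (p , τ) 1≤n k≤n 1≤p =
  proportions-close n (p ^ k) (binom k 2) 1≤n 1≤t 1≤t₃
    (occ-lower π) (non-occ-lower π) (occ+non-occ π (n , σ)) (occ+non-occ π σ₃) defect
  where
  open InflationCounts σ τ
  1≤t : 1 ≤ n C k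
  1≤t = subst (1 ≤_) (binom≡C n k) (binom-pos n k k≤n)
  1≤t₃ : 1 ≤ (n * p) C k
  1≤t₃ = subst (1 ≤_) (binom≡C (n * p) k) (binom-pos (n * p) k (≤-trans k≤n (≤-*-pos n 1≤p)))
  defect : n * ((n * p) C k) ≤ n * (p ^ k * (n C k)) + binom k 2 * ((n * p) C k)
  defect = subst₂ (λ t₃ t → n * t₃ ≤ n * (p ^ k * t) + binom k 2 * t₃) (binom≡C (n * p) k) (binom≡C n k)
    (binomial-defect n p binom-lower k)

theorem4p1 : (k : ℕ) → 1 ≤ k → (v₁ v₂ : PVec k) → P k v₁ → clP k v₂ →
    (σ₁ σ₂ : ℕ → Perm) →
    SizeDiverges σ₁ → CConv k σ₁ v₁ →
    SizeDiverges σ₂ → Conv k σ₂ v₂ →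
    SizeDiverges (λ m → inflate (σ₂ m) (σ₁ m)) ×
    CConv k (λ m → inflate (σ₂ m) (σ₁ m)) v₁ ×
    Conv k (λ m → inflate (σ₂ m) (σ₁ m)) v₂
theorem4p1 (suc k) _ v₁ v₂ _ _ σ₁ σ₂ σ₁→∞ σ₁⟶v₁ σ₂→∞ σ₂⟶v₂ = sizes , c-limits , limits
  where
  -- eventually |σ₁ᵐ| ≥ 1 and |σ₂ᵐ| ≥ k+1, so that both error bounds apply
  large : Eventually (λ m → 1 ≤ size (σ₁ m) × suc k ≤ size (σ₂ m))
  large = eventually-both (σ₁→∞ 1) (σ₂→∞ (suc k))

  sizes : SizeDiverges (λ m → inflate (σ₂ m) (σ₁ m))
  sizes B = eventually-map (λ m (1≤p , B≤n) → ≤-trans B≤n (≤-*-pos (size (σ₂ m)) 1≤p))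
    (eventually-both (σ₁→∞ 1) (σ₂→∞ B))

  c-limits : CConv (suc k) (λ m → inflate (σ₂ m) (σ₁ m)) v₁
  c-limits π = limit-transfer-rate (λ m → c-occ~ π (inflate (σ₂ m) (σ₁ m))) (λ m → c-occ~ π (σ₁ m)) (v₁ π) (size ∘ σ₁) k σ₁→∞
    (eventually-map (λ m (1≤p , k<n) → c-occ~-inflate π (σ₂ m) (σ₁ m) (≤-trans (s≤s z≤n) k<n) 1≤p) large)
    (σ₁⟶v₁ π)

  limits : Conv (suc k) (λ m → inflate (σ₂ m) (σ₁ m)) v₂
  limits π = limit-transfer-rate (λ m → occ~ π (inflate (σ₂ m) (σ₁ m))) (λ m → occ~ π (σ₂ m)) (v₂ π) (size ∘ σ₂) (binom (suc k) 2) σ₂→∞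
    (eventually-map (λ m (1≤p , k<n) → occ~-inflate π (σ₂ m) (σ₁ m) (≤-trans (s≤s z≤n) k<n) k<n 1≤p) large)
    (σ₂⟶v₂ π)
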